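{- Let $n\ge 2$ be an integer and $\log$ denote $\log_2$. Define vectors $\Delta_k=(\delta_k^1,\dots,\delta_k^{2^k})$ for $0\le k\le\lfloor\log n\rfloor$ recursively by $\Delta_0=(n)$ and, for $k\ge 1$, \[\Delta_k=(\alpha_k,\ \delta_{k-1}^1-\alpha_k,\ \alpha_k,\ \delta_{k-1}^2-\alpha_k,\ \dots,\ \alpha_k,\ \delta_{k-1}^{2^{k-1}}-\alpha_k),\] where $\alpha_k=\lfloor n/2^{k-1}\rfloor/2$ if $\lfloor n/2^{k-1}\rfloor$ is even, and $\alpha_k=\big\lfloor \lceil n/2^{k-1}\rceil/2\big\rfloor$ otherwise. Then for every $0<k\le\lfloor\log n\rfloor$: (1) $\sum_{i=1}^{2^k}\delta_k^i=n$; (2) for every $1\le i\le 2^k$, $\delta_k^i\in\{\lceil n/2^k\rceil,\lfloor n/2^k\rfloor\}$; in particular $\alpha_k\in\{\lfloor n/2^k\rfloor,\lceil n/2^k\rceil\}$. -}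

module Defs where

open import Data.Bool using (if_then_else_)
open import Data.Nat as ℕ using (ℕ; zero; suc; _∸_; _^_; NonZero; ⌊_/2⌋; _%_; _≡ᵇ_)
open import Data.Nat.DivMod using (_/_)
open import Data.Nat.Properties using (m^n≢0; *-comm)
open import Data.Integer as ℤ using (ℤ; +_)
open import Data.Vec using (Vec; []; _∷_; cast; concat; map; foldr)

pow2 : ℕ → ℕ
pow2 k = 2 ^ k

floorDiv2^ : ℕ → ℕ → ℕ
floorDiv2^ m k = _/_ m (pow2 k) {{m^n≢0 2 k}}

ceilDiv2^ : ℕ → ℕ → ℕ
ceilDiv2^ m k = _/_ (m ℕ.+ pow2 k ∸ 1) (pow2 k) {{m^n≢0 2 k}}

-- α_k for k ≥ 1 (alpha n k = α_{k+1} is written as alpha n (suc j) with j = k-1):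
--   m = ⌊ n / 2^(k-1) ⌋;  α_k = m/2 if m even, else ⌊ ⌈ n / 2^(k-1) ⌉ / 2 ⌋
-- (alpha n 0 is unused; set to 0.)
alpha : ℕ → ℕ → ℕ
alpha n zero = 0
alpha n (suc j) =
  if floorDiv2^ n j % 2 ≡ᵇ 0
  then ⌊ floorDiv2^ n j /2⌋
  else ⌊ ceilDiv2^ n j /2⌋

Delta : ℕ → (k : ℕ) → Vec ℤ (pow2 k)
Delta n zero = + n ∷ []
Delta n (suc k) =
  cast (*-comm (pow2 k) 2)
    (concat (map (λ d → + alpha n (suc k) ∷ (d ℤ.- + alpha n (suc k)) ∷ []) (Delta n k)))

sumℤ : ∀ {m} → Vec ℤ m → ℤ
sumℤ = foldr _ ℤ._+_ (+ 0)

-- Write a = ⌊n/2^k⌋ and c = ⌈n/2^k⌉, so that c ∈ {a, a+1}, ⌊a/2⌋ = ⌊n/2^(k+1)⌋ and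
-- ⌈c/2⌉ = ⌈n/2^(k+1)⌉.  If c = a then α = ⌊a/2⌋ and a − α = ⌈a/2⌉.  If c = a+1 then
-- α = ⌈a/2⌉ whatever the parity of a, and a − α = ⌊a/2⌋, (a+1) − α = ⌊a/2⌋ + 1 = ⌈c/2⌉.
-- Hence splitting every entry d of Δ_k into (α, d − α) turns entries in {a, c} into
-- entries in {⌊a/2⌋, ⌈c/2⌉}, while preserving the sum.
module Submission where

open import Defs
open import Data.Nat using (ℕ; _≤_; _<_)
open import Data.Nat.Logarithm using (⌊log₂_⌋)
open import Data.Integer using (+_)
open import Data.Fin using (Fin)
open import Data.Vec using (lookup)
open import Data.Product using (_×_)
open import Data.Sum using (_⊎_)
open import Relation.Binary.PropositionalEquality using (_≡_)

open import Level using (Level)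
open import Data.Bool using (true; false; if_then_else_; T)
open import Data.Unit using (tt)
open import Data.Nat using (zero; suc; _+_; _*_; _∸_; NonZero; ⌊_/2⌋; ⌈_/2⌉; _%_; _≡ᵇ_; s≤s; z≤n)
open import Data.Nat.Properties
open import Data.Nat.DivMod
open import Data.Nat.Solver using (module +-*-Solver)
open import Data.Integer as ℤ using (ℤ)
open import Data.Integer.Properties as ℤ using ([+m]-[+n]≡m⊖n; ⊖-≥)
open import Data.Integer.Tactic.RingSolver using (solve-∀)
open import Data.Vec using (Vec; cast; concat; map; []; _∷_)
open import Data.Vec.Properties using (cast-is-id)
open import Data.Vec.Relation.Unary.All as All using (All; []; _∷_)
open import Data.Vec.Relation.Unary.All.Properties using (lookup⁺; map⁺; concat⁺)
open import Data.Product using (∃-syntax; _,_)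
open import Data.Sum as Sum using (inj₁; inj₂)
open import Relation.Binary.PropositionalEquality
  using (refl; sym; trans; cong; subst; module ≡-Reasoning)

private
  variable
    ℓ : Level
    A : Set
    m n : ℕ

n/2≡⌊n/2⌋ : ∀ n → n / 2 ≡ ⌊ n /2⌋
n/2≡⌊n/2⌋ zero          = refl
n/2≡⌊n/2⌋ (suc zero)    = refl
n/2≡⌊n/2⌋ (suc (suc n)) =
  trans (m/n≡1+[m∸n]/n {suc (suc n)} {2} (s≤s (s≤s z≤n))) (cong suc (n/2≡⌊n/2⌋ n))

[m+d]/d≡1+m/d : ∀ m d .{{_ : NonZero d}} → (m + d) / d ≡ suc (m / d)
[m+d]/d≡1+m/d m d = trans (m/n≡1+[m∸n]/n (m≤n+m d m)) (cong (λ x → suc (x / d)) (m+n∸n≡m m d))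

⌊m/d/2⌋≡m/[2d] : ∀ m d .{{_ : NonZero d}} → ⌊ m / d /2⌋ ≡ (m / (2 * d)) {{m*n≢0 2 d}}
⌊m/d/2⌋≡m/[2d] m d = begin
  ⌊ m / d /2⌋                 ≡⟨ sym (n/2≡⌊n/2⌋ (m / d)) ⟩
  m / d / 2                   ≡⟨ m/n/o≡m/[n*o] m d 2 {{_}} {{_}} {{m*n≢0 d 2}} ⟩
  (m / (d * 2)) {{m*n≢0 d 2}} ≡⟨ /-congʳ {{m*n≢0 d 2}} {{m*n≢0 2 d}} (*-comm d 2) ⟩
  (m / (2 * d)) {{m*n≢0 2 d}} ∎
  where open ≡-Reasoning

⌈m/d/2⌉≡m/[2d] : ∀ m d .{{_ : NonZero d}} →
                 ⌈ (m + d ∸ 1) / d /2⌉ ≡ ((m + 2 * d ∸ 1) / (2 * d)) {{m*n≢0 2 d}}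
⌈m/d/2⌉≡m/[2d] m (suc e) = begin
  ⌊ suc ((m + suc e ∸ 1) / suc e) /2⌋   ≡⟨ cong ⌊_/2⌋ (sym ([m+d]/d≡1+m/d (m + suc e ∸ 1) (suc e))) ⟩
  ⌊ (m + suc e ∸ 1 + suc e) / suc e /2⌋ ≡⟨ ⌊m/d/2⌋≡m/[2d] (m + suc e ∸ 1 + suc e) (suc e) ⟩
  (m + suc e ∸ 1 + suc e) / d′          ≡⟨ cong (_/ d′) numerators ⟩
  (m + d′ ∸ 1) / d′                     ∎
  where
  open ≡-Reasoning
  open +-*-Solver
  d′ = 2 * suc e
  numerators : m + suc e ∸ 1 + suc e ≡ m + d′ ∸ 1
  numerators = begin
    m + suc e ∸ 1 + suc e ≡⟨ cong (λ x → x ∸ 1 + suc e) (+-suc m e) ⟩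
    m + e + suc e         ≡⟨ solve 2 (λ m e → m :+ e :+ (con 1 :+ e)
                                          := m :+ (e :+ (con 1 :+ (e :+ con 0)))) refl m e ⟩
    m + (e + suc (e + 0)) ≡⟨ cong (_∸ 1) (sym (+-suc m (e + suc (e + 0)))) ⟩
    m + d′ ∸ 1            ∎

m≤n≤1+m⇒n≡m⊎n≡1+m : m ≤ n → n ≤ suc m → n ≡ m ⊎ n ≡ suc m
m≤n≤1+m⇒n≡m⊎n≡1+m m≤n n≤1+m with m≤n⇒m<n∨m≡n n≤1+m
... | inj₁ n<1+m = inj₁ (≤-antisym (m<1+n⇒m≤n n<1+m) m≤n)
... | inj₂ n≡1+m = inj₂ n≡1+m

⌈m/d⌉≡⌊m/d⌋⊎1+⌊m/d⌋ : ∀ m d .{{_ : NonZero d}} →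
                       (m + d ∸ 1) / d ≡ m / d ⊎ (m + d ∸ 1) / d ≡ suc (m / d)
⌈m/d⌉≡⌊m/d⌋⊎1+⌊m/d⌋ m (suc e) rewrite cong (_∸ 1) (+-suc m e) =
  m≤n≤1+m⇒n≡m⊎n≡1+m (/-monoˡ-≤ (suc e) (m≤m+n m e)) (begin
    (m + e) / suc e     ≤⟨ /-monoˡ-≤ (suc e) (+-monoʳ-≤ m (n≤1+n e)) ⟩
    (m + suc e) / suc e ≡⟨ [m+d]/d≡1+m/d m (suc e) ⟩
    suc (m / suc e)     ∎)
  where open ≤-Reasoning

n%2≡0⇒⌊n/2⌋≡⌈n/2⌉ : ∀ n → n % 2 ≡ 0 → ⌊ n /2⌋ ≡ ⌈ n /2⌉
n%2≡0⇒⌊n/2⌋≡⌈n/2⌉ zero          _    = refl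
n%2≡0⇒⌊n/2⌋≡⌈n/2⌉ (suc (suc n)) even = cong suc (n%2≡0⇒⌊n/2⌋≡⌈n/2⌉ n even)

⌈n/2⌉≡⌊n/2⌋⊎1+⌊n/2⌋ : ∀ n → ⌈ n /2⌉ ≡ ⌊ n /2⌋ ⊎ ⌈ n /2⌉ ≡ suc ⌊ n /2⌋
⌈n/2⌉≡⌊n/2⌋⊎1+⌊n/2⌋ zero          = inj₁ refl
⌈n/2⌉≡⌊n/2⌋⊎1+⌊n/2⌋ (suc zero)    = inj₂ refl
⌈n/2⌉≡⌊n/2⌋⊎1+⌊n/2⌋ (suc (suc n)) =
  Sum.map (cong suc) (cong suc) (⌈n/2⌉≡⌊n/2⌋⊎1+⌊n/2⌋ n)

-- alpha n (suc k) unfolds to splitPoint (floorDiv2^ n k) (ceilDiv2^ n k).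
splitPoint : ℕ → ℕ → ℕ
splitPoint a c = if a % 2 ≡ᵇ 0 then ⌊ a /2⌋ else ⌊ c /2⌋

splitPoint-diag : ∀ a → splitPoint a a ≡ ⌊ a /2⌋
splitPoint-diag a with a % 2 ≡ᵇ 0
... | true  = refl
... | false = refl

splitPoint-suc : ∀ a → splitPoint a (suc a) ≡ ⌈ a /2⌉
splitPoint-suc a with a % 2 ≡ᵇ 0 in even
... | true  = n%2≡0⇒⌊n/2⌋≡⌈n/2⌉ a (≡ᵇ⇒≡ (a % 2) 0 (subst T (sym even) tt))
... | false = refl

⌈n/2⌉+⌊n/2⌋≡n : ∀ n → ⌈ n /2⌉ + ⌊ n /2⌋ ≡ n
⌈n/2⌉+⌊n/2⌋≡n n = trans (+-comm ⌈ n /2⌉ ⌊ n /2⌋) (⌊n/2⌋+⌈n/2⌉≡n n)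

splitPoint-diag-remainder : ∀ a → a ≡ splitPoint a a + ⌈ a /2⌉
splitPoint-diag-remainder a =
  trans (sym (⌊n/2⌋+⌈n/2⌉≡n a)) (cong (_+ ⌈ a /2⌉) (sym (splitPoint-diag a)))

splitPoint-suc-remainderˡ : ∀ a → a ≡ splitPoint a (suc a) + ⌊ a /2⌋
splitPoint-suc-remainderˡ a =
  trans (sym (⌈n/2⌉+⌊n/2⌋≡n a)) (cong (_+ ⌊ a /2⌋) (sym (splitPoint-suc a)))

splitPoint-suc-remainderʳ : ∀ a → suc a ≡ splitPoint a (suc a) + suc ⌊ a /2⌋
splitPoint-suc-remainderʳ a =
  trans (cong suc (splitPoint-suc-remainderˡ a)) (sym (+-suc (splitPoint a (suc a)) ⌊ a /2⌋))

splitPoint-bounds : ∀ {a c} → c ≡ a ⊎ c ≡ suc a →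
                    splitPoint a c ≡ ⌊ a /2⌋ ⊎ splitPoint a c ≡ ⌈ c /2⌉
splitPoint-bounds {a} (inj₁ refl) = inj₁ (splitPoint-diag a)
splitPoint-bounds {a} (inj₂ refl) =
  Sum.map (trans (splitPoint-suc a)) (trans (splitPoint-suc a)) (⌈n/2⌉≡⌊n/2⌋⊎1+⌊n/2⌋ a)

splitPoint-remainder : ∀ {a c x} → c ≡ a ⊎ c ≡ suc a → x ≡ a ⊎ x ≡ c →
                       ∃[ y ] x ≡ splitPoint a c + y × (y ≡ ⌊ a /2⌋ ⊎ y ≡ ⌈ c /2⌉)
splitPoint-remainder {a} (inj₁ refl) (inj₁ refl) = ⌈ a /2⌉ , splitPoint-diag-remainder a , inj₂ refl
splitPoint-remainder {a} (inj₁ refl) (inj₂ refl) = ⌈ a /2⌉ , splitPoint-diag-remainder a , inj₂ refl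
splitPoint-remainder {a} (inj₂ refl) (inj₁ refl) = ⌊ a /2⌋ , splitPoint-suc-remainderˡ a , inj₁ refl
splitPoint-remainder {a} (inj₂ refl) (inj₂ refl) =
  suc ⌊ a /2⌋ , splitPoint-suc-remainderʳ a , inj₂ refl

IsRoundedQuotient : ℕ → ℕ → ℕ → Set
IsRoundedQuotient n k y = y ≡ floorDiv2^ n k ⊎ y ≡ ceilDiv2^ n k

floorDiv2^-suc : ∀ n k → ⌊ floorDiv2^ n k /2⌋ ≡ floorDiv2^ n (suc k)
floorDiv2^-suc n k = ⌊m/d/2⌋≡m/[2d] n (pow2 k) {{m^n≢0 2 k}}

ceilDiv2^-suc : ∀ n k → ⌈ ceilDiv2^ n k /2⌉ ≡ ceilDiv2^ n (suc k)
ceilDiv2^-suc n k = ⌈m/d/2⌉≡m/[2d] n (pow2 k) {{m^n≢0 2 k}}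

ceilDiv2^≡floorDiv2^⊎1+floorDiv2^ : ∀ n k →
  ceilDiv2^ n k ≡ floorDiv2^ n k ⊎ ceilDiv2^ n k ≡ suc (floorDiv2^ n k)
ceilDiv2^≡floorDiv2^⊎1+floorDiv2^ n k = ⌈m/d⌉≡⌊m/d⌋⊎1+⌊m/d⌋ n (pow2 k) {{m^n≢0 2 k}}

halved-isRoundedQuotient : ∀ n k {y} →
  y ≡ ⌊ floorDiv2^ n k /2⌋ ⊎ y ≡ ⌈ ceilDiv2^ n k /2⌉ → IsRoundedQuotient n (suc k) y
halved-isRoundedQuotient n k =
  Sum.map (λ e → trans e (floorDiv2^-suc n k)) (λ e → trans e (ceilDiv2^-suc n k))

alpha-isRoundedQuotient : ∀ n k → IsRoundedQuotient n (suc k) (alpha n (suc k))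
alpha-isRoundedQuotient n k =
  halved-isRoundedQuotient n k (splitPoint-bounds (ceilDiv2^≡floorDiv2^⊎1+floorDiv2^ n k))

-- Delta n (suc k) unfolds to cast _ (concat (map (split (alpha n (suc k))) (Delta n k))).
split : ℕ → ℤ → Vec ℤ 2
split α d = + α ∷ d ℤ.- + α ∷ []

cast-preserves : (P : ∀ {m} → Vec A m → Set ℓ) (eq : m ≡ n) {xs : Vec A m} →
                 P xs → P (cast eq xs)
cast-preserves P refl {xs} = subst P (sym (cast-is-id refl xs))

sumℤ-concat-split : ∀ α (xs : Vec ℤ m) → sumℤ (concat (map (split α) xs)) ≡ sumℤ xs
sumℤ-concat-split α []       = refl
sumℤ-concat-split α (d ∷ xs) =
  trans (split-cancels (+ α) d _) (cong (λ r → d ℤ.+ r) (sumℤ-concat-split α xs))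
  where
  split-cancels : ∀ a d r → a ℤ.+ ((d ℤ.- a) ℤ.+ r) ≡ d ℤ.+ r
  split-cancels = solve-∀

Delta-sum : ∀ n k → sumℤ (Delta n k) ≡ + n
Delta-sum n zero    = ℤ.+-identityʳ (+ n)
Delta-sum n (suc k) = cast-preserves (λ xs → sumℤ xs ≡ + n) (*-comm (pow2 k) 2)
  (trans (sumℤ-concat-split (alpha n (suc k)) (Delta n k)) (Delta-sum n k))

IsRoundedQuotientℤ : ℕ → ℕ → ℤ → Set
IsRoundedQuotientℤ n k z = ∃[ y ] z ≡ + y × IsRoundedQuotient n k y

+[m+n]-+m≡+n : ∀ m n → + (m + n) ℤ.- + m ≡ + n
+[m+n]-+m≡+n m n =
  trans ([+m]-[+n]≡m⊖n (m + n) m) (trans (⊖-≥ (m≤m+n m n)) (cong +_ (m+n∸m≡n m n)))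

split-isRoundedQuotientℤ : ∀ n k {z} → IsRoundedQuotientℤ n k z →
                           All (IsRoundedQuotientℤ n (suc k)) (split (alpha n (suc k)) z)
split-isRoundedQuotientℤ n k (x , refl , x∈)
  with splitPoint-remainder (ceilDiv2^≡floorDiv2^⊎1+floorDiv2^ n k) x∈
... | y , refl , y∈ = (alpha n (suc k) , refl , alpha-isRoundedQuotient n k)
                    ∷ (y , +[m+n]-+m≡+n (alpha n (suc k)) y , halved-isRoundedQuotient n k y∈)
                    ∷ []

Delta-isRoundedQuotientℤ : ∀ n k → All (IsRoundedQuotientℤ n k) (Delta n k)
Delta-isRoundedQuotientℤ n zero    = (n , refl , inj₁ (sym (n/1≡n n))) ∷ []
Delta-isRoundedQuotientℤ n (suc k) =
  cast-preserves (All (IsRoundedQuotientℤ n (suc k))) (*-comm (pow2 k) 2)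
    (concat⁺ (map⁺ (All.map (split-isRoundedQuotientℤ n k) (Delta-isRoundedQuotientℤ n k))))

-- α₀ = 0 is a dummy value, hence k ≥ 1; the bounds 2 ≤ n and k ≤ ⌊log₂ n⌋ are not needed.
lemma4 : (n : ℕ) → 2 ≤ n → (k : ℕ) → 0 < k → k ≤ ⌊log₂ n ⌋ →
         (sumℤ (Delta n k) ≡ + n)
         × ((i : Fin (pow2 k)) →
             (lookup (Delta n k) i ≡ + ceilDiv2^ n k) ⊎ (lookup (Delta n k) i ≡ + floorDiv2^ n k))
         × ((alpha n k ≡ floorDiv2^ n k) ⊎ (alpha n k ≡ ceilDiv2^ n k))
lemma4 n _ (suc k) _ _ = Delta-sum n (suc k) , entry-bounds , alpha-isRoundedQuotient n k
  where
  entry-bounds : (i : Fin (pow2 (suc k))) →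
                 lookup (Delta n (suc k)) i ≡ + ceilDiv2^ n (suc k)
                 ⊎ lookup (Delta n (suc k)) i ≡ + floorDiv2^ n (suc k)
  entry-bounds i with lookup⁺ (Delta-isRoundedQuotientℤ n (suc k)) i
  ... | _ , z≡y , inj₁ refl = inj₂ z≡y
  ... | _ , z≡y , inj₂ refl = inj₁ z≡y
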